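{- For any equivalence relations $E,F$ on $\mathbb N$, $(E\oplus F)^+$ is computably bireducible with $E^+\times F^+$.
   Context: $E\leq F$ (computable reducibility) means there is a total computable $f$ with $n\mathrel{E}n'\iff f(n)\mathrel{F}f(n')$; bireducible means $E\leq F$ and $F\leq E$. $E\oplus F$ is the equivalence relation on $\mathbb N\times\{0,1\}$ with $(m,i)(E\oplus F)(n,j)$ iff ($i=j=0$ and $m\mathrel{E}n$) or ($i=j=1$ and $m\mathrel{F}n$). $E\times F$ is the equivalence relation on $\mathbb N\times\mathbb N$ with $(m,n)(E\times F)(m',n')$ iff $m\mathrel{E}m'$ and $n\mathrel{F}n'$. These are regarded as equivalence relations on $\mathbb N$ via a standard computable pairing. The computable FS-jump $E^+$ of an equivalence relation $E$ on $\mathbb N$ (identified with $\mathbb N$ via pairing) is defined on $\mathbb N$ by $e\mathrel{E^+}e'$ iff $\{[\phi_e(n)]_E:\phi_e(n)\downarrow\}=\{[\phi_{e'}(n)]_E:\phi_{e'}(n)\downarrow\}$, where $\phi_e$ is the $e$-th partial computable function. -}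

module Defs where

open import Data.Nat using (ℕ; zero; suc; _+_; _*_; _<_)
open import Data.Product using (Σ; _×_; _,_)
open import Data.Sum using (_⊎_)
open import Relation.Binary.PropositionalEquality using (_≡_)

tri : ℕ → ℕ
tri zero    = zero
tri (suc k) = suc k + tri k

pair : ℕ → ℕ → ℕ
pair a b = tri (a + b) + b

-- Codes for partial recursive functions (unary, multi-arguments via pairing)
-- as in Mathlib's Nat.Partrec.Code, with the standard μ-operator.

data Code : Set where
  zero' succ' left' right' : Code
  pair' comp' prec' : Code → Code → Code
  rfind' : Code → Code

data Eval : Code → ℕ → ℕ → Set where
  ev-zero  : ∀ n → Eval zero' n 0
  ev-succ  : ∀ n → Eval succ' n (suc n)
  ev-left  : ∀ a b → Eval left' (pair a b) a
  ev-right : ∀ a b → Eval right' (pair a b) b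
  ev-pair  : ∀ {f g n a b} → Eval f n a → Eval g n b → Eval (pair' f g) n (pair a b)
  ev-comp  : ∀ {f g n m k} → Eval g n m → Eval f m k → Eval (comp' f g) n k
  ev-prec0 : ∀ {f g a r} → Eval f a r → Eval (prec' f g) (pair a 0) r
  ev-precS : ∀ {f g a i r s} → Eval (prec' f g) (pair a i) r →
             Eval g (pair a (pair i r)) s → Eval (prec' f g) (pair a (suc i)) s
  ev-rfind : ∀ {f a k} → Eval f (pair a k) 0 →
             (∀ j → j < k → Σ ℕ (λ v → Eval f (pair a j) (suc v))) →
             Eval (rfind' f) a k

-- Gödel numbering of codes (bijective onto ℕ, Mathlib-style).
encode : Code → ℕ
encode zero'        = 0
encode succ'        = 1
encode left'        = 2
encode right'       = 3
encode (pair' f g)  = 4 + 4 * pair (encode f) (encode g)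
encode (comp' f g)  = 4 + (4 * pair (encode f) (encode g) + 1)
encode (prec' f g)  = 4 + (4 * pair (encode f) (encode g) + 2)
encode (rfind' f)   = 4 + (4 * encode f + 3)

Φ : ℕ → ℕ → ℕ → Set
Φ e n m = Σ Code (λ c → encode c ≡ e × Eval c n m)

Computable : (ℕ → ℕ) → Set
Computable f = Σ Code (λ c → ∀ n → Eval c n (f n))

BinRel : Set₁
BinRel = ℕ → ℕ → Set

_≤c_ : BinRel → BinRel → Set
E ≤c F = Σ (ℕ → ℕ) (λ f → Computable f ×
           (∀ n n' → (E n n' → F (f n) (f n')) × (F (f n) (f n') → E n n')))

Bireducible : BinRel → BinRel → Set
Bireducible E F = (E ≤c F) × (F ≤c E)

-- E ⊕ F, with ℕ × {0,1} identified with ℕ via (m,0) ↦ 2m, (m,1) ↦ 2m+1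
_⊕_ : BinRel → BinRel → BinRel
(E ⊕ F) x y =
  Σ ℕ (λ m → Σ ℕ (λ n → x ≡ 2 * m × y ≡ 2 * n × E m n)) ⊎
  Σ ℕ (λ m → Σ ℕ (λ n → x ≡ suc (2 * m) × y ≡ suc (2 * n) × F m n))

-- E × F, with ℕ × ℕ identified with ℕ via Cantor pairing
_⊗_ : BinRel → BinRel → BinRel
(E ⊗ F) x y = Σ ℕ λ m → Σ ℕ λ n → Σ ℕ λ m' → Σ ℕ λ n' →
  x ≡ pair m n × y ≡ pair m' n' × E m m' × F n n'

-- computable FS-jump: {[φ_e(n)]_E : φ_e(n)↓} = {[φ_e'(n)]_E : φ_e'(n)↓}
Jump : BinRel → BinRel
Jump E e e' =
  (∀ n m → Φ e n m → Σ ℕ λ n' → Σ ℕ λ m' → Φ e' n' m' × E m m') ×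
  (∀ n' m' → Φ e' n' m' → Σ ℕ λ n → Σ ℕ λ m → Φ e n m × E m m')

module Submission where

-- (E ⊕ F)⁺ and E⁺ × F⁺ are computably bireducible. The reductions below work for arbitrary
-- relations E, F.
--
-- In (E ⊕ F)⁺ an index e matters only through the set of values of φ_e, and that set splits
-- into its even part and its odd part, compared separately by E and by F (match-⊕). Writing
-- ι L y = 2y and ι R y = 2y + 1: e ↦ ⟨restrict L e , restrict R e⟩ reduces (E ⊕ F)⁺ to E⁺ × F⁺,
-- where restrict s e indexes a program whose values are the y with ι s y a value of φ_e; and
-- ⟨a , b⟩ ↦ merge a b reduces E⁺ × F⁺ to (E ⊕ F)⁺, where merge a b indexes a program whose values
-- are the ι L (φ_a k) and the ι R (φ_b k).

open import Data.Empty using (⊥-elim)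
open import Data.Nat using (ℕ; zero; suc; _+_; _*_; _∸_; _⊔_; _≤_; _<_; z≤n; s≤s; pred)
open import Data.Nat.Divisibility using (divides-refl)
open import Data.Nat.DivMod
  using (_/_; _%_; m≡m%n+[m/n]*n; m%n<n; m/n≤m; [m+kn]%n≡m%n; m<n⇒m%n≡m; +-distrib-/-∣ʳ; m<n⇒m/n≡0; m*n/n≡m)
open import Data.Nat.Properties
open import Data.Product using (Σ; _×_; _,_; proj₁; proj₂)
open import Data.Sum using (inj₁; inj₂)
open import Function.Bundles using (_⇔_; mk⇔; Equivalence)
open import Function.Properties.Equivalence using () renaming (trans to ⇔-trans; sym to ⇔-sym)
open import Relation.Binary.Definitions using (tri<; tri≈; tri>)
open import Relation.Binary.PropositionalEquality
open import Relation.Binary.Structures using (IsEquivalence)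

open import Defs

-- Cantor pairing ⟨a , b⟩ = tri (a + b) + b enumerates the diagonals a + b = s in turn.
tri-mono : ∀ {s s'} → s ≤ s' → tri s ≤ tri s'
tri-mono {zero}  _         = z≤n
tri-mono {suc s} (s≤s s≤s') = +-mono-≤ (s≤s s≤s') (tri-mono s≤s')

tri-step : ∀ s b b' s' → b ≤ s → s < s' → tri s + b < tri s' + b'
tri-step s b b' s' b≤s s<s' = begin-strict
    tri s + b      ≤⟨ +-monoʳ-≤ (tri s) b≤s ⟩
    tri s + s      <⟨ +-monoʳ-< (tri s) (n<1+n s) ⟩
    tri s + suc s  ≡⟨ +-comm (tri s) (suc s) ⟩
    tri (suc s)    ≤⟨ tri-mono s<s' ⟩
    tri s'         ≤⟨ m≤m+n (tri s') b' ⟩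
    tri s' + b'    ∎
  where open ≤-Reasoning

-- Hence pairing is injective: equal pairs lie on the same diagonal, at the same position.
pair-injective : ∀ {a b a' b'} → pair a b ≡ pair a' b' → a ≡ a' × b ≡ b'
pair-injective {a} {b} {a'} {b'} eq with <-cmp (a + b) (a' + b')
... | tri< lt _ _ = ⊥-elim (<⇒≢ (tri-step (a + b) b b' (a' + b') (m≤n+m b a) lt) eq)
... | tri> _ _ gt = ⊥-elim (<⇒≢ (tri-step (a' + b') b' b (a + b) (m≤n+m b' a') gt) (sym eq))
... | tri≈ _ same _ = a≡a' , b≡b'
  where
  b≡b' : b ≡ b'
  b≡b' = +-cancelˡ-≡ (tri (a + b)) b b' (trans eq (cong (λ s → tri s + b') (sym same)))
  a≡a' : a ≡ a'
  a≡a' = +-cancelʳ-≡ b a a' (trans same (cong (a' +_) (sym b≡b')))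

unpair : ℕ → ℕ × ℕ
unpair zero = 0 , 0
unpair (suc n) with unpair n
... | suc a , b = a , suc b
... | zero  , b = suc b , 0

fst snd : ℕ → ℕ
fst n = proj₁ (unpair n)
snd n = proj₂ (unpair n)

pair-unpair : ∀ n → pair (fst n) (snd n) ≡ n
pair-unpair zero = refl
pair-unpair (suc n) with unpair n | pair-unpair n
... | suc a , b | eq = begin
    tri (a + suc b) + suc b      ≡⟨ cong (λ s → tri s + suc b) (+-suc a b) ⟩
    tri (suc (a + b)) + suc b    ≡⟨ +-suc (tri (suc (a + b))) b ⟩
    suc (tri (suc a + b) + b)    ≡⟨ cong suc eq ⟩
    suc n                        ∎
  where open ≡-Reasoning
... | zero , b | eq = begin
    tri (suc b + 0) + 0          ≡⟨ +-identityʳ _ ⟩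
    tri (suc b + 0)              ≡⟨ cong (λ s → tri (suc s)) (+-identityʳ b) ⟩
    suc (b + tri b)              ≡⟨ cong suc (+-comm b (tri b)) ⟩
    suc (tri b + b)              ≡⟨ cong suc eq ⟩
    suc n                        ∎
  where open ≡-Reasoning

unpair-pair : ∀ a b → fst (pair a b) ≡ a × snd (pair a b) ≡ b
unpair-pair a b = pair-injective (pair-unpair (pair a b))

fst≤pair : ∀ a b → a ≤ pair a b
fst≤pair a b = ≤-trans (m≤m+n a b) (≤-trans (tri-inflationary (a + b)) (m≤m+n _ b))
  where
  tri-inflationary : ∀ s → s ≤ tri s
  tri-inflationary zero    = z≤n
  tri-inflationary (suc s) = m≤m+n (suc s) (tri s)

snd≤pair : ∀ a b → b ≤ pair a b
snd≤pair a b = m≤n+m b (tri (a + b))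

data Side : Set where
  L R : Side

-- ι s embeds ℕ as the even (s = L) or the odd (s = R) numbers; this is how E ⊕ F codes ℕ × {0,1}.
ι : Side → ℕ → ℕ
ι L y = 2 * y
ι R y = suc (2 * y)

ι-injective : ∀ {s s' y z} → ι s y ≡ ι s' z → s ≡ s' × y ≡ z
ι-injective {L} {L} {y} {z} eq = refl , *-cancelˡ-≡ y z 2 eq
ι-injective {L} {R} {y} {z} eq = ⊥-elim (even≢odd y z eq)
ι-injective {R} {L} {y} {z} eq = ⊥-elim (even≢odd z y (sym eq))
ι-injective {R} {R} {y} {z} eq = refl , *-cancelˡ-≡ y z 2 (suc-injective eq)

ι-surjective : ∀ x → Σ Side λ s → Σ ℕ λ y → x ≡ ι s y
ι-surjective zero = L , 0 , refl
ι-surjective (suc x) with ι-surjective x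
... | L , y , x≡2y   = R , y , cong suc x≡2y
... | R , y , x≡2y+1 = L , suc y , trans (cong suc x≡2y+1) (sym (*-suc 2 y))

choose : ∀ {a} {A : Set a} → Side → A → A → A
choose L x y = x
choose R x y = y

-- An enumeration P lists values: P n m reads "the n-th entry is m" (entries may be missing).
Enumeration : Set₁
Enumeration = ℕ → ℕ → Set

-- P and Q have E-matching values: every value of either is E-related to a value of the other,
-- E pointing from P to Q. By definition, Jump E e e' is Match E (Φ e) (Φ e').
Match : BinRel → Enumeration → Enumeration → Set
Match E P Q = (∀ n m → P n m → Σ ℕ λ n' → Σ ℕ λ m' → Q n' m' × E m m') ×
              (∀ n' m' → Q n' m' → Σ ℕ λ n → Σ ℕ λ m → P n m × E m m')

record Splits (M : Enumeration) (P : Side → Enumeration) : Set where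
  field
    from-side : ∀ s {n y} → M n (ι s y) → Σ ℕ λ k → P s k y
    to-side   : ∀ s {k y} → P s k y → Σ ℕ λ n → M n (ι s y)
open Splits

module _ {E F : BinRel} where

  Summand : Side → BinRel
  Summand s = choose s E F

  ⊕-intro : ∀ s {y z} → Summand s y z → (E ⊕ F) (ι s y) (ι s z)
  ⊕-intro L r = inj₁ (_ , _ , refl , refl , r)
  ⊕-intro R r = inj₂ (_ , _ , refl , refl , r)

  ⊕-elim : ∀ {x x'} → (E ⊕ F) x x' →
           Σ Side λ s → Σ ℕ λ y → Σ ℕ λ z → x ≡ ι s y × x' ≡ ι s z × Summand s y z
  ⊕-elim (inj₁ (y , z , x≡ , x'≡ , r)) = L , y , z , x≡ , x'≡ , r
  ⊕-elim (inj₂ (y , z , x≡ , x'≡ , r)) = R , y , z , x≡ , x'≡ , r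

  ⊕-elimˡ : ∀ s {y x'} → (E ⊕ F) (ι s y) x' → Σ ℕ λ z → x' ≡ ι s z × Summand s y z
  ⊕-elimˡ s r with ⊕-elim r
  ... | s' , y' , z , x≡ , x'≡ , r' with ι-injective {s} {s'} x≡
  ... | refl , refl = z , x'≡ , r'

  ⊕-elimʳ : ∀ s {x z} → (E ⊕ F) x (ι s z) → Σ ℕ λ y → x ≡ ι s y × Summand s y z
  ⊕-elimʳ s r with ⊕-elim r
  ... | s' , y , z' , x≡ , x'≡ , r' with ι-injective {s} {s'} x'≡
  ... | refl , refl = y , x≡ , r'

  module _ {M M' : Enumeration} {P P' : Side → Enumeration}
           (split : Splits M P) (split' : Splits M' P') where

    match-sides : Match (E ⊕ F) M M' → ∀ s → Match (Summand s) (P s) (P' s)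
    match-sides (forth , back) s = forth-side , back-side
      where
      forth-side : ∀ k y → P s k y → Σ ℕ λ k' → Σ ℕ λ z → P' s k' z × Summand s y z
      forth-side k y p with to-side split s p
      ... | n , mn with forth n (ι s y) mn
      ... | n' , x' , m'x' , r with ⊕-elimˡ s r
      ... | z , refl , rz with from-side split' s m'x'
      ... | k' , p'k' = k' , z , p'k' , rz
      back-side : ∀ k' z → P' s k' z → Σ ℕ λ k → Σ ℕ λ y → P s k y × Summand s y z
      back-side k' z p' with to-side split' s p'
      ... | n' , m'n' with back n' (ι s z) m'n'
      ... | n , x , mx , r with ⊕-elimʳ s r
      ... | y , refl , ry with from-side split s mx
      ... | k , pk = k , y , pk , ry

    match-sum : (∀ s → Match (Summand s) (P s) (P' s)) → Match (E ⊕ F) M M'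
    match-sum sides = forth , back
      where
      forth : ∀ n x → M n x → Σ ℕ λ n' → Σ ℕ λ x' → M' n' x' × (E ⊕ F) x x'
      forth n x mx with ι-surjective x
      ... | s , y , refl with from-side split s mx
      ... | k , pk with proj₁ (sides s) k y pk
      ... | k' , z , p'k' , r with to-side split' s p'k'
      ... | n' , m'n' = n' , ι s z , m'n' , ⊕-intro s r
      back : ∀ n' x' → M' n' x' → Σ ℕ λ n → Σ ℕ λ x → M n x × (E ⊕ F) x x'
      back n' x' m'x' with ι-surjective x'
      ... | s , z , refl with from-side split' s m'x'
      ... | k' , p'k' with proj₂ (sides s) k' z p'k'
      ... | k , y , pk , r with to-side split s pk
      ... | n , mn = n , ι s y , mn , ⊕-intro s r

match-⊕ : ∀ {E F M M' P P'} → Splits M P → Splits M' P' →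
          Match (E ⊕ F) M M' ⇔ (Match E (P L) (P' L) × Match F (P R) (P' R))
match-⊕ split split' = mk⇔
  (λ J → match-sides split split' J L , match-sides split split' J R)
  (λ (matchL , matchR) → match-sum split split' λ { L → matchL ; R → matchR })

⊗-pair : ∀ {E F a b a' b'} → (E ⊗ F) (pair a b) (pair a' b') ⇔ (E a a' × F b b')
⊗-pair {E} {F} {a} {b} {a'} {b'} = mk⇔ to (λ (r , s) → a , b , a' , b' , refl , refl , r , s)
  where
  to : (E ⊗ F) (pair a b) (pair a' b') → E a a' × F b b'
  to (m , n , m' , n' , p , q , r , s)
    with pair-injective {a} {b} {m} {n} p | pair-injective {a'} {b'} {m'} {n'} q
  ... | refl , refl | refl , refl = r , s

⊗-unpair : ∀ {E F x x'} → (E ⊗ F) x x' ⇔ (E (fst x) (fst x') × F (snd x) (snd x'))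
⊗-unpair {E} {F} {x} {x'} =
  subst₂ (λ y y' → (E ⊗ F) y y' ⇔ (E (fst x) (fst x') × F (snd x) (snd x')))
         (pair-unpair x) (pair-unpair x')
         (⊗-pair {E} {F} {fst x} {snd x} {fst x'} {snd x'})

reduction : ∀ {E F} f → Computable f → (∀ n n' → E n n' ⇔ F (f n) (f n')) → E ≤c F
reduction f computable iff = f , computable , λ n n' → Equivalence.to (iff n n') , Equivalence.from (iff n n')

-- A non-atomic code is numbered nodeIndex r p: r < 4 is its constructor tag, p its payload
-- (pair (encode f) (encode g) for binary nodes, encode f for rfind' f). Atoms are numbered 0 … 3.
nodeIndex : ℕ → ℕ → ℕ
nodeIndex r p = 4 + (4 * p + r)

tag-payload : ∀ p r → r < 4 → (4 * p + r) % 4 ≡ r × (4 * p + r) / 4 ≡ p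
tag-payload p r r<4 = (begin
    (4 * p + r) % 4    ≡⟨ cong (_% 4) 4p+r≡r+p4 ⟩
    (r + p * 4) % 4    ≡⟨ [m+kn]%n≡m%n r p 4 ⟩
    r % 4              ≡⟨ m<n⇒m%n≡m r<4 ⟩
    r                  ∎) , (begin
    (4 * p + r) / 4    ≡⟨ cong (_/ 4) 4p+r≡r+p4 ⟩
    (r + p * 4) / 4    ≡⟨ +-distrib-/-∣ʳ r (divides-refl p) ⟩
    r / 4 + p * 4 / 4  ≡⟨ cong₂ _+_ (m<n⇒m/n≡0 r<4) (m*n/n≡m p 4) ⟩
    p                  ∎)
  where
  open ≡-Reasoning
  4p+r≡r+p4 : 4 * p + r ≡ r + p * 4
  4p+r≡r+p4 = trans (+-comm (4 * p) r) (cong (r +_) (*-comm 4 p))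

decodeNode : (ℕ → Code) → ℕ → ℕ → Code
decodeNode d 0 p = pair' (d (fst p)) (d (snd p))
decodeNode d 1 p = comp' (d (fst p)) (d (snd p))
decodeNode d 2 p = prec' (d (fst p)) (d (snd p))
decodeNode d _ p = rfind' (d p)

decodeWith : ℕ → ℕ → Code
decodeWith zero    _ = zero'
decodeWith (suc k) 0 = zero'
decodeWith (suc k) 1 = succ'
decodeWith (suc k) 2 = left'
decodeWith (suc k) 3 = right'
decodeWith (suc k) (suc (suc (suc (suc m)))) = decodeNode (decodeWith k) (m % 4) (m / 4)

-- The program with index n; the budget suc n suffices (encode-decode).
decode : ℕ → Code
decode n = decodeWith (suc n) n

-- Nesting depth of a code: a sufficient budget for decoding its number.
depth : Code → ℕ
depth (pair' f g) = suc (depth f ⊔ depth g)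
depth (comp' f g) = suc (depth f ⊔ depth g)
depth (prec' f g) = suc (depth f ⊔ depth g)
depth (rfind' f)  = suc (depth f)
depth _           = 1

decodeWith-node : ∀ k p r → r < 4 → decodeWith (suc k) (nodeIndex r p) ≡ decodeNode (decodeWith k) r p
decodeWith-node k p r r<4 = cong₂ (decodeNode (decodeWith k)) (proj₁ tp) (proj₂ tp)
  where tp = tag-payload p r r<4

decodeWith-encode : ∀ c {k} → depth c ≤ k → decodeWith k (encode c) ≡ c
decodeWith-fst : ∀ f g {k} → depth f ⊔ depth g ≤ k → decodeWith k (fst (pair (encode f) (encode g))) ≡ f
decodeWith-snd : ∀ f g {k} → depth f ⊔ depth g ≤ k → decodeWith k (snd (pair (encode f) (encode g))) ≡ g

decodeWith-encode zero'  (s≤s _) = refl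
decodeWith-encode succ'  (s≤s _) = refl
decodeWith-encode left'  (s≤s _) = refl
decodeWith-encode right' (s≤s _) = refl
decodeWith-encode (pair' f g) {suc k} (s≤s le) = begin
    decodeWith (suc k) (4 + 4 * P)        ≡⟨ cong (λ x → decodeWith (suc k) (4 + x)) (sym (+-identityʳ (4 * P))) ⟩
    decodeWith (suc k) (4 + (4 * P + 0))  ≡⟨ decodeWith-node k P 0 (s≤s z≤n) ⟩
    pair' (decodeWith k (fst P)) (decodeWith k (snd P))
      ≡⟨ cong₂ pair' (decodeWith-fst f g le) (decodeWith-snd f g le) ⟩
    pair' f g                             ∎
  where
  open ≡-Reasoning
  P = pair (encode f) (encode g)
decodeWith-encode (comp' f g) {suc k} (s≤s le) =
  trans (decodeWith-node k (pair (encode f) (encode g)) 1 (s≤s (s≤s z≤n)))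
        (cong₂ comp' (decodeWith-fst f g le) (decodeWith-snd f g le))
decodeWith-encode (prec' f g) {suc k} (s≤s le) =
  trans (decodeWith-node k (pair (encode f) (encode g)) 2 (s≤s (s≤s (s≤s z≤n))))
        (cong₂ prec' (decodeWith-fst f g le) (decodeWith-snd f g le))
decodeWith-encode (rfind' f) {suc k} (s≤s le) =
  trans (decodeWith-node k (encode f) 3 (s≤s (s≤s (s≤s (s≤s z≤n)))))
        (cong rfind' (decodeWith-encode f le))

decodeWith-fst f g {k} le =
  trans (cong (decodeWith k) (proj₁ (unpair-pair (encode f) (encode g))))
        (decodeWith-encode f (m⊔n≤o⇒m≤o (depth f) (depth g) le))

decodeWith-snd f g {k} le =
  trans (cong (decodeWith k) (proj₂ (unpair-pair (encode f) (encode g))))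
        (decodeWith-encode g (m⊔n≤o⇒n≤o (depth f) (depth g) le))

-- Distinct codes have distinct numbers, since a common budget decodes both.
encode-injective : ∀ {c c'} → encode c ≡ encode c' → c ≡ c'
encode-injective {c} {c'} eq = begin
    c                          ≡⟨ sym (decodeWith-encode c (m≤m⊔n (depth c) (depth c'))) ⟩
    decodeWith K (encode c)    ≡⟨ cong (decodeWith K) eq ⟩
    decodeWith K (encode c')   ≡⟨ decodeWith-encode c' (m≤n⊔m (depth c) (depth c')) ⟩
    c'                         ∎
  where
  open ≡-Reasoning
  K = depth c ⊔ depth c'

payload-children : (d : ℕ → Code) (p : ℕ) → (∀ x → x ≤ p → encode (d x) ≡ x) →
                   pair (encode (d (fst p))) (encode (d (snd p))) ≡ p
payload-children d p inv = trans (cong₂ pair (inv (fst p) fst≤p) (inv (snd p) snd≤p)) (pair-unpair p)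
  where
  fst≤p = subst (fst p ≤_) (pair-unpair p) (fst≤pair (fst p) (snd p))
  snd≤p = subst (snd p ≤_) (pair-unpair p) (snd≤pair (fst p) (snd p))

encode-decodeNode : (d : ℕ → Code) (r p : ℕ) → r < 4 → (∀ x → x ≤ p → encode (d x) ≡ x) →
                    encode (decodeNode d r p) ≡ nodeIndex r p
encode-decodeNode d 0 p _ inv =
  cong (4 +_) (trans (cong (4 *_) (payload-children d p inv)) (sym (+-identityʳ (4 * p))))
encode-decodeNode d 1 p _ inv = cong (λ q → 4 + (4 * q + 1)) (payload-children d p inv)
encode-decodeNode d 2 p _ inv = cong (λ q → 4 + (4 * q + 2)) (payload-children d p inv)
encode-decodeNode d 3 p _ inv = cong (λ q → 4 + (4 * q + 3)) (inv p ≤-refl)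
encode-decodeNode d (suc (suc (suc (suc _)))) p (s≤s (s≤s (s≤s (s≤s ())))) _

encode-decodeWith : ∀ k n → n < k → encode (decodeWith k n) ≡ n
encode-decodeWith (suc k) 0 _ = refl
encode-decodeWith (suc k) 1 _ = refl
encode-decodeWith (suc k) 2 _ = refl
encode-decodeWith (suc k) 3 _ = refl
encode-decodeWith (suc k) (suc (suc (suc (suc m)))) (s≤s 4+m<k) = begin
    encode (decodeNode (decodeWith k) (m % 4) (m / 4))  ≡⟨ encode-decodeNode _ (m % 4) (m / 4) (m%n<n m 4) inv ⟩
    4 + (4 * (m / 4) + m % 4)                           ≡⟨ cong (4 +_) division ⟩
    4 + m                                               ∎
  where
  open ≡-Reasoning
  m<k : m < k
  m<k = ≤-trans (s≤s (m≤n+m m 3)) 4+m<k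
  inv : ∀ x → x ≤ m / 4 → encode (decodeWith k x) ≡ x
  inv x x≤q = encode-decodeWith k x (≤-<-trans (≤-trans x≤q (m/n≤m m 4)) m<k)
  division : 4 * (m / 4) + m % 4 ≡ m
  division = trans (trans (+-comm _ (m % 4)) (cong (m % 4 +_) (*-comm 4 (m / 4)))) (sym (m≡m%n+[m/n]*n m 4))

encode-decode : ∀ n → encode (decode n) ≡ n
encode-decode n = encode-decodeWith (suc n) n ≤-refl

decode-encode : ∀ c → decode (encode c) ≡ c
decode-encode c = encode-injective (encode-decode (encode c))

-- Since encode is a bijection, "φ_e(n) = m" is just evaluation of the decoded program.
Φ→Eval : ∀ {e n m} → Φ e n m → Eval (decode e) n m
Φ→Eval (c , refl , ev) = subst (λ d → Eval d _ _) (sym (decode-encode c)) ev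

Eval→Φ : ∀ {e n m} → Eval (decode e) n m → Φ e n m
Eval→Φ {e} ev = decode e , encode-decode e , ev

-- Programs are deterministic (stated for equal rather than identical inputs, as the recursion needs).
eval-det : ∀ {c n n' m m'} → Eval c n m → Eval c n' m' → n ≡ n' → m ≡ m'
eval-det (ev-zero _) (ev-zero _) _ = refl
eval-det (ev-succ _) (ev-succ _) eq = cong suc eq
eval-det (ev-left a b) (ev-left a' b') eq = proj₁ (pair-injective {a} {b} {a'} {b'} eq)
eval-det (ev-right a b) (ev-right a' b') eq = proj₂ (pair-injective {a} {b} {a'} {b'} eq)
eval-det (ev-pair f g) (ev-pair f' g') eq = cong₂ pair (eval-det f f' eq) (eval-det g g' eq)
eval-det (ev-comp g f) (ev-comp g' f') eq = eval-det f f' (eval-det g g' eq)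
eval-det (ev-prec0 {a = a} f) (ev-prec0 {a = a'} f') eq =
  eval-det f f' (proj₁ (pair-injective {a} {0} {a'} {0} eq))
eval-det (ev-prec0 {a = a} _) (ev-precS {a = a'} {i = i} _ _) eq
  with () ← proj₂ (pair-injective {a} {0} {a'} {suc i} eq)
eval-det (ev-precS {a = a} {i = i} _ _) (ev-prec0 {a = a'} _) eq
  with () ← proj₂ (pair-injective {a} {suc i} {a'} {0} eq)
eval-det (ev-precS {a = a} {i = i} r g) (ev-precS {a = a'} {i = i'} r' g') eq =
  let a≡a' , i+1≡i'+1 = pair-injective {a} {suc i} {a'} {suc i'} eq
      i≡i' = suc-injective i+1≡i'+1
  in eval-det g g' (cong₂ pair a≡a' (cong₂ pair i≡i' (eval-det r r' (cong₂ pair a≡a' i≡i'))))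
eval-det (ev-rfind {k = k} z h) (ev-rfind {k = k'} z' h') eq with <-cmp k k'
... | tri≈ _ k≡k' _ = k≡k'
... | tri< k<k' _ _ = ⊥-elim (0≢1+n (eval-det z (proj₂ (h' k k<k')) (cong₂ pair eq refl)))
... | tri> _ _ k>k' = ⊥-elim (0≢1+n (eval-det z' (proj₂ (h k' k>k')) (cong₂ pair (sym eq) refl)))

comp-inv : ∀ {f g n m} → Eval (comp' f g) n m → Σ ℕ λ y → Eval g n y × Eval f y m
comp-inv (ev-comp g f) = _ , g , f

pair-inv : ∀ {f g n z} → Eval (pair' f g) n z →
           Σ ℕ λ a → Σ ℕ λ b → z ≡ pair a b × Eval f n a × Eval g n b
pair-inv (ev-pair f g) = _ , _ , refl , f , g

eval-≡ : ∀ {c n m m'} → Eval c n m → m ≡ m' → Eval c n m'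
eval-≡ ev refl = ev

left-eval : ∀ n → Eval left' n (fst n)
left-eval n = subst (λ x → Eval left' x (fst n)) (pair-unpair n) (ev-left (fst n) (snd n))

right-eval : ∀ n → Eval right' n (snd n)
right-eval n = subst (λ x → Eval right' x (snd n)) (pair-unpair n) (ev-right (fst n) (snd n))

idP : Code
idP = pair' left' right'

id-eval : ∀ n → Eval idP n n
id-eval n = eval-≡ (ev-pair (left-eval n) (right-eval n)) (pair-unpair n)

constP : ℕ → Code
constP zero    = zero'
constP (suc k) = comp' succ' (constP k)

const-eval : ∀ k n → Eval (constP k) n k
const-eval zero    n = ev-zero n
const-eval (suc k) n = ev-comp (const-eval k n) (ev-succ k)

addP : Code
addP = prec' idP (comp' succ' (comp' right' right'))

add-eval : ∀ a b → Eval addP (pair a b) (a + b)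
add-eval a zero    = eval-≡ (ev-prec0 (id-eval a)) (sym (+-identityʳ a))
add-eval a (suc b) = eval-≡ (ev-precS {a = a} {i = b} (add-eval a b) step) (sym (+-suc a b))
  where
  step = ev-comp (ev-comp (ev-right a (pair b (a + b))) (ev-right b (a + b))) (ev-succ (a + b))

predP : Code
predP = prec' zero' (comp' left' right')

pred-eval : ∀ a b → Eval predP (pair a b) (pred b)
pred-eval a zero    = ev-prec0 (ev-zero a)
pred-eval a (suc b) = ev-precS {a = a} {i = b} (pred-eval a b) step
  where step = ev-comp (ev-right a (pair b (pred b))) (ev-left b (pred b))

monusP : Code
monusP = prec' idP (comp' predP right')

monus-eval : ∀ a b → Eval monusP (pair a b) (a ∸ b)
monus-eval a zero    = ev-prec0 (id-eval a)
monus-eval a (suc b) = eval-≡ (ev-precS {a = a} {i = b} (monus-eval a b) step) (pred[m∸n]≡m∸[1+n] a b)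
  where step = ev-comp (ev-right a (pair b (a ∸ b))) (pred-eval b (a ∸ b))

_⊞_ : Code → Code → Code
X ⊞ Y = comp' addP (pair' X Y)

⊞-eval : ∀ {X Y n x y} → Eval X n x → Eval Y n y → Eval (X ⊞ Y) n (x + y)
⊞-eval {x = x} {y} ex ey = ev-comp (ev-pair ex ey) (add-eval x y)

⊞-inv : ∀ {X Y n m} → Eval (X ⊞ Y) n m → Σ ℕ λ x → Σ ℕ λ y → Eval X n x × Eval Y n y × m ≡ x + y
⊞-inv ev with comp-inv ev
... | z , ep , ea with pair-inv ep
... | x , y , z≡xy , ex , ey = x , y , ex , ey , eval-det ea (add-eval x y) z≡xy

_⊟_ : Code → Code → Code
X ⊟ Y = comp' monusP (pair' X Y)

⊟-eval : ∀ {X Y n x y} → Eval X n x → Eval Y n y → Eval (X ⊟ Y) n (x ∸ y)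
⊟-eval {x = x} {y} ex ey = ev-comp (ev-pair ex ey) (monus-eval x y)

doubleP : Code
doubleP = idP ⊞ idP

double-eval : ∀ n → Eval doubleP n (2 * n)
double-eval n = eval-≡ (⊞-eval (id-eval n) (id-eval n)) (cong (n +_) (sym (+-identityʳ n)))

sideP : Side → Code
sideP L = doubleP
sideP R = comp' succ' doubleP

side-eval : ∀ s y → Eval (sideP s) y (ι s y)
side-eval L y = double-eval y
side-eval R y = ev-comp (double-eval y) (ev-succ (2 * y))

distance : ℕ → ℕ → ℕ
distance y t = (y ∸ t) + (t ∸ y)

distance≡0 : ∀ y t → distance y t ≡ 0 → y ≡ t
distance≡0 y t d≡0 =
  ≤-antisym (m∸n≡0⇒m≤n (m+n≡0⇒m≡0 (y ∸ t) d≡0)) (m∸n≡0⇒m≤n (m+n≡0⇒n≡0 (y ∸ t) d≡0))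

distanceP : Code → Code
distanceP T = (left' ⊟ comp' T right') ⊞ (comp' T right' ⊟ left')

distance-eval : ∀ {T} y k t → Eval T k t → Eval (distanceP T) (pair y k) (distance y t)
distance-eval y k t et = ⊞-eval (⊟-eval (ev-left y k) Tk) (⊟-eval Tk (ev-left y k))
  where Tk = ev-comp (ev-right y k) et

-- unside s searches for the y with ι s y equal to its input: a partial inverse of ι s,
-- halting exactly on the numbers of side s.
unsideP : Side → Code
unsideP s = rfind' (distanceP (sideP s))

unside-inv : ∀ s {x y} → Eval (unsideP s) x y → x ≡ ι s y
unside-inv s {x} {y} (ev-rfind d≡0 _) =
  distance≡0 x (ι s y) (sym (eval-det d≡0 (distance-eval x y (ι s y) (side-eval s y)) refl))

unside-eval : ∀ s y → Eval (unsideP s) (ι s y) y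
unside-eval s y = ev-rfind (eval-≡ (distance-eval (ι s y) y (ι s y) (side-eval s y)) d≡0) earlier
  where
  d≡0 : distance (ι s y) (ι s y) ≡ 0
  d≡0 = cong₂ _+_ (n∸n≡0 (ι s y)) (n∸n≡0 (ι s y))
  positive : ∀ {d} → d ≢ 0 → Σ ℕ λ v → d ≡ suc v
  positive {zero}  d≢0 = ⊥-elim (d≢0 refl)
  positive {suc v} _   = v , refl
  earlier : ∀ j → j < y → Σ ℕ λ v → Eval (distanceP (sideP s)) (pair (ι s y) j) (suc v)
  earlier j j<y =
    let v , d≡1+v = positive (λ d≡0 → <⇒≢ j<y (sym (proj₂ (ι-injective {s} {s} (distance≡0 _ _ d≡0)))))
    in v , eval-≡ (distance-eval (ι s y) j (ι s j) (side-eval s j)) d≡1+v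

-- guard c outputs 0 on ⟨k , 0⟩ and runs c on k at ⟨k , 1⟩. Crucially, on ⟨k , 0⟩ it does not
-- run c, so it halts even where c diverges.
guardP : Code → Code
guardP c = prec' zero' (comp' c left')

guard-off : ∀ c k → Eval (guardP c) (pair k 0) 0
guard-off c k = ev-prec0 (ev-zero k)

guard-off-inv : ∀ {c} k {x} → Eval (guardP c) (pair k 0) x → x ≡ 0
guard-off-inv {c} k ev = eval-det ev (guard-off c k) refl

guard-on : ∀ {c k y} → Eval c k y → Eval (guardP c) (pair k 1) y
guard-on {k = k} ev = ev-precS {a = k} {i = 0} (guard-off _ k) (ev-comp (ev-left k (pair 0 0)) ev)

guard-on-inv : ∀ {c k y} → Eval (guardP c) (pair k 1) y → Eval c k y
guard-on-inv ev = go ev refl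
  where
  go : ∀ {c k x y} → Eval (guardP c) x y → x ≡ pair k 1 → Eval c k y
  go {k = k} (ev-prec0 {a = a} _) eq with () ← proj₂ (pair-injective {a} {0} {k} {1} eq)
  go {k = k} (ev-precS {a = a} {i = i} {r = r} _ step) eq with pair-injective {a} {suc i} {k} {1} eq
  ... | refl , refl with comp-inv step
  ... | y , eleft , ec = subst (λ z → Eval _ z _) (eval-det eleft (ev-left a (pair 0 r)) refl) ec

onSide : Side → ℕ → ℕ
onSide L zero    = 1
onSide L (suc _) = 0
onSide R zero    = 0
onSide R (suc _) = 1

flagP : Side → Code
flagP L = prec' (constP 1) zero'
flagP R = prec' zero' (constP 1)

flag-eval : ∀ s k i → Eval (flagP s) (pair k i) (onSide s i)
flag-eval L k zero    = ev-prec0 (const-eval 1 k)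
flag-eval L k (suc i) = ev-precS {a = k} {i = i} (flag-eval L k i) (ev-zero _)
flag-eval R k zero    = ev-prec0 (ev-zero k)
flag-eval R k (suc i) = ev-precS {a = k} {i = i} (flag-eval R k i) (const-eval 1 _)

branchP : Side → Code → Code
branchP s c = comp' (guardP (comp' (sideP s) c)) (pair' left' (flagP s))

branch-select : ∀ s k i → Eval (pair' left' (flagP s)) (pair k i) (pair k (onSide s i))
branch-select s k i = ev-pair (ev-left k i) (flag-eval s k i)

branch-inv : ∀ s {c} k i {m} → Eval (branchP s c) (pair k i) m →
             Eval (guardP (comp' (sideP s) c)) (pair k (onSide s i)) m
branch-inv s k i ev with comp-inv ev
... | z , eselect , eguard =
  subst (λ x → Eval _ x _) (eval-det eselect (branch-select s k i) refl) eguard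

tag : Side → ℕ
tag L = 0
tag R = 1

branch-active : ∀ s {c k y} → Eval c k y → Eval (branchP s c) (pair k (tag s)) (ι s y)
branch-active L {k = k} {y} ev = ev-comp (branch-select L k 0) (guard-on (ev-comp ev (side-eval L y)))
branch-active R {k = k} {y} ev = ev-comp (branch-select R k 1) (guard-on (ev-comp ev (side-eval R y)))

branch-idle : ∀ s {c} k i → onSide s i ≡ 0 → Eval (branchP s c) (pair k i) 0
branch-idle s k i off =
  ev-comp (subst (λ f → Eval _ (pair k i) (pair k f)) off (branch-select s k i)) (guard-off _ k)

branch-active-inv : ∀ s {c} k {x} → Eval (guardP (comp' (sideP s) c)) (pair k 1) x →
                    Σ ℕ λ y → Eval c k y × x ≡ ι s y
branch-active-inv s k ev with comp-inv (guard-on-inv ev)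
... | y , ec , eside = y , ec , eval-det eside (side-eval s y) refl

-- The merge of a and b: on ⟨k , 0⟩ it outputs ι L (a k), on ⟨k , i+1⟩ it outputs ι R (b k).
-- Its outputs are thus exactly the ι L-images of outputs of a and the ι R-images of outputs of b.
mergeP : Code → Code → Code
mergeP a b = branchP L a ⊞ branchP R b

merge-eval : ∀ s {a b k y} → Eval (choose s a b) k y → Eval (mergeP a b) (pair k (tag s)) (ι s y)
merge-eval L {k = k} {y} ev =
  eval-≡ (⊞-eval (branch-active L ev) (branch-idle R k 0 refl)) (+-identityʳ (ι L y))
merge-eval R {k = k} ev = ⊞-eval (branch-idle L k 1 refl) (branch-active R ev)

merge-inv : ∀ {a b n m} → Eval (mergeP a b) n m →
            Σ Side λ s → Σ ℕ λ k → Σ ℕ λ y → Eval (choose s a b) k y × m ≡ ι s y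
merge-inv {n = n} ev = at (fst n) (snd n) (subst (λ x → Eval _ x _) (sym (pair-unpair n)) ev)
  where
  at : ∀ {a b m} k i → Eval (mergeP a b) (pair k i) m →
       Σ Side λ s → Σ ℕ λ k → Σ ℕ λ y → Eval (choose s a b) k y × m ≡ ι s y
  at k i ev with ⊞-inv ev
  at k zero ev | xL , xR , eL , eR , m≡xL+xR with branch-active-inv L k (branch-inv L k 0 eL)
  ... | y , ea , xL≡ιy = L , k , y , ea , (begin
      _             ≡⟨ m≡xL+xR ⟩
      xL + xR       ≡⟨ cong₂ _+_ xL≡ιy (guard-off-inv k (branch-inv R k 0 eR)) ⟩
      ι L y + 0     ≡⟨ +-identityʳ (ι L y) ⟩
      ι L y         ∎)
    where open ≡-Reasoning
  at k (suc i) ev | xL , xR , eL , eR , m≡xL+xR with branch-active-inv R k (branch-inv R k (suc i) eR)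
  ... | y , eb , xR≡ιy =
    R , k , y , eb , trans m≡xL+xR (cong₂ _+_ (guard-off-inv k (branch-inv L k (suc i) eL)) xR≡ιy)

nodeIndexP : ℕ → Code
nodeIndexP r = constP 4 ⊞ (comp' doubleP doubleP ⊞ constP r)

nodeIndex-eval : ∀ r p → Eval (nodeIndexP r) p (nodeIndex r p)
nodeIndex-eval r p = ⊞-eval (const-eval 4 p) (⊞-eval times4 (const-eval r p))
  where
  times4 : Eval (comp' doubleP doubleP) p (4 * p)
  times4 = eval-≡ (ev-comp (double-eval p) (double-eval (2 * p))) (sym (*-assoc 2 2 p))

binaryNodeP : ℕ → Code → Code → Code
binaryNodeP r X Y = comp' (nodeIndexP r) (pair' X Y)

binaryNode-eval : ∀ r {X Y n x y} → Eval X n x → Eval Y n y → Eval (binaryNodeP r X Y) n (nodeIndex r (pair x y))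
binaryNode-eval r {x = x} {y} ex ey = ev-comp (ev-pair ex ey) (nodeIndex-eval r (pair x y))

pairNode-eval : ∀ {X Y n x y} → Eval X n x → Eval Y n y → Eval (binaryNodeP 0 X Y) n (4 + 4 * pair x y)
pairNode-eval {x = x} {y} ex ey = eval-≡ (binaryNode-eval 0 ex ey) (cong (4 +_) (+-identityʳ (4 * pair x y)))

quoteP : Code → Code
quoteP zero'       = constP 0
quoteP succ'       = constP 1
quoteP left'       = constP 2
quoteP right'      = constP 3
quoteP (pair' f g) = binaryNodeP 0 (quoteP f) (quoteP g)
quoteP (comp' f g) = binaryNodeP 1 (quoteP f) (quoteP g)
quoteP (prec' f g) = binaryNodeP 2 (quoteP f) (quoteP g)
quoteP (rfind' f)  = comp' (nodeIndexP 3) (quoteP f)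

quote-eval : ∀ c n → Eval (quoteP c) n (encode c)
quote-eval zero'       n = const-eval 0 n
quote-eval succ'       n = const-eval 1 n
quote-eval left'       n = const-eval 2 n
quote-eval right'      n = const-eval 3 n
quote-eval (pair' f g) n = pairNode-eval (quote-eval f n) (quote-eval g n)
quote-eval (comp' f g) n = binaryNode-eval 1 (quote-eval f n) (quote-eval g n)
quote-eval (prec' f g) n = binaryNode-eval 2 (quote-eval f n) (quote-eval g n)
quote-eval (rfind' f)  n = ev-comp (quote-eval f n) (nodeIndex-eval 3 (encode f))

-- Instantiating the holes is computable on indices (an s-m-n theorem):
-- fillIndex computes the index of the instance from the indices of the arguments, and
-- fillP computes fillIndex from programs computing those indices.
data Template : Set where
  hole₀ hole₁       : Template
  const             : Code → Template
  pairᵗ compᵗ precᵗ : Template → Template → Template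
  rfindᵗ            : Template → Template

fill : Template → Code → Code → Code
fill hole₀        a b = a
fill hole₁        a b = b
fill (const c)    a b = c
fill (pairᵗ s t)  a b = pair' (fill s a b) (fill t a b)
fill (compᵗ s t)  a b = comp' (fill s a b) (fill t a b)
fill (precᵗ s t)  a b = prec' (fill s a b) (fill t a b)
fill (rfindᵗ s)   a b = rfind' (fill s a b)

fillIndex : Template → ℕ → ℕ → ℕ
fillIndex hole₀       a b = a
fillIndex hole₁       a b = b
fillIndex (const c)   a b = encode c
fillIndex (pairᵗ s t) a b = 4 + 4 * pair (fillIndex s a b) (fillIndex t a b)
fillIndex (compᵗ s t) a b = nodeIndex 1 (pair (fillIndex s a b) (fillIndex t a b))
fillIndex (precᵗ s t) a b = nodeIndex 2 (pair (fillIndex s a b) (fillIndex t a b))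
fillIndex (rfindᵗ s)  a b = nodeIndex 3 (fillIndex s a b)

encode-fill : ∀ t a b → encode (fill t a b) ≡ fillIndex t (encode a) (encode b)
encode-fill hole₀       a b = refl
encode-fill hole₁       a b = refl
encode-fill (const c)   a b = refl
encode-fill (pairᵗ s t) a b = cong₂ (λ x y → 4 + 4 * pair x y) (encode-fill s a b) (encode-fill t a b)
encode-fill (compᵗ s t) a b = cong₂ (λ x y → nodeIndex 1 (pair x y)) (encode-fill s a b) (encode-fill t a b)
encode-fill (precᵗ s t) a b = cong₂ (λ x y → nodeIndex 2 (pair x y)) (encode-fill s a b) (encode-fill t a b)
encode-fill (rfindᵗ s)  a b = cong (nodeIndex 3) (encode-fill s a b)

decode-fillIndex : ∀ t a b → decode (fillIndex t a b) ≡ fill t (decode a) (decode b)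
decode-fillIndex t a b = encode-injective (begin
    encode (decode (fillIndex t a b))                    ≡⟨ encode-decode (fillIndex t a b) ⟩
    fillIndex t a b                                      ≡⟨ sym (cong₂ (fillIndex t) (encode-decode a) (encode-decode b)) ⟩
    fillIndex t (encode (decode a)) (encode (decode b))  ≡⟨ sym (encode-fill t (decode a) (decode b)) ⟩
    encode (fill t (decode a) (decode b))                ∎)
  where open ≡-Reasoning

fillP : Template → Code → Code → Code
fillP hole₀       X Y = X
fillP hole₁       X Y = Y
fillP (const c)   X Y = quoteP c
fillP (pairᵗ s t) X Y = binaryNodeP 0 (fillP s X Y) (fillP t X Y)
fillP (compᵗ s t) X Y = binaryNodeP 1 (fillP s X Y) (fillP t X Y)
fillP (precᵗ s t) X Y = binaryNodeP 2 (fillP s X Y) (fillP t X Y)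
fillP (rfindᵗ s)  X Y = comp' (nodeIndexP 3) (fillP s X Y)

fill-eval : ∀ t {X Y n a b} → Eval X n a → Eval Y n b → Eval (fillP t X Y) n (fillIndex t a b)
fill-eval hole₀       ea eb = ea
fill-eval hole₁       ea eb = eb
fill-eval (const c) {n = n} ea eb = quote-eval c n
fill-eval (pairᵗ s t) ea eb = pairNode-eval (fill-eval s ea eb) (fill-eval t ea eb)
fill-eval (compᵗ s t) ea eb = binaryNode-eval 1 (fill-eval s ea eb) (fill-eval t ea eb)
fill-eval (precᵗ s t) ea eb = binaryNode-eval 2 (fill-eval s ea eb) (fill-eval t ea eb)
fill-eval (rfindᵗ s)  ea eb = ev-comp (fill-eval s ea eb) (nodeIndex-eval 3 _)

Φ-fill→ : ∀ t {a b n m} → Φ (fillIndex t a b) n m → Eval (fill t (decode a) (decode b)) n m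
Φ-fill→ t {a} {b} φ = subst (λ c → Eval c _ _) (decode-fillIndex t a b) (Φ→Eval φ)

Φ-fill← : ∀ t {a b n m} → Eval (fill t (decode a) (decode b)) n m → Φ (fillIndex t a b) n m
Φ-fill← t {a} {b} ev = Eval→Φ (subst (λ c → Eval c _ _) (sym (decode-fillIndex t a b)) ev)

-- The template of unside s ∘ hole₀. It is opaque, as is mergeT below: unfolding a concrete template
-- would make Agda normalise the astronomically large indices of its fixed subprograms.
opaque
  restrictT : Side → Template
  restrictT s = compᵗ (const (unsideP s)) hole₀

  fill-restrictT : ∀ s a b → fill (restrictT s) a b ≡ comp' (unsideP s) a
  fill-restrictT s a b = refl

restrict : Side → ℕ → ℕ
restrict s e = fillIndex (restrictT s) e e

Φ-restrict→ : ∀ s {e k y} → Φ (restrict s e) k y → Eval (comp' (unsideP s) (decode e)) k y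
Φ-restrict→ s {e} φ = subst (λ c → Eval c _ _) (fill-restrictT s (decode e) (decode e)) (Φ-fill→ (restrictT s) φ)

Φ-restrict← : ∀ s {e k y} → Eval (comp' (unsideP s) (decode e)) k y → Φ (restrict s e) k y
Φ-restrict← s {e} ev =
  Φ-fill← (restrictT s) (subst (λ c → Eval c _ _) (sym (fill-restrictT s (decode e) (decode e))) ev)

restrict-splits : ∀ e → Splits (Φ e) (λ s → Φ (restrict s e))
restrict-splits e = record { from-side = from ; to-side = to }
  where
  from : ∀ s {n y} → Φ e n (ι s y) → Σ ℕ λ k → Φ (restrict s e) k y
  from s {n} {y} φ = n , Φ-restrict← s (ev-comp (Φ→Eval φ) (unside-eval s y))
  to : ∀ s {k y} → Φ (restrict s e) k y → Σ ℕ λ n → Φ e n (ι s y)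
  to s {k} φ with comp-inv (Φ-restrict→ s φ)
  ... | x , ex , eunside = k , Eval→Φ (subst (Eval _ k) (unside-inv s eunside) ex)

opaque
  mergeT : Template
  mergeT = compᵗ (const addP) (pairᵗ (branchT L hole₀) (branchT R hole₁))
    where
    branchT : Side → Template → Template
    branchT s h = compᵗ (precᵗ (const zero') (compᵗ (compᵗ (const (sideP s)) h) (const left')))
                        (const (pair' left' (flagP s)))

  fill-mergeT : ∀ a b → fill mergeT a b ≡ mergeP a b
  fill-mergeT a b = refl

merge : ℕ → ℕ → ℕ
merge a b = fillIndex mergeT a b

Φ-merge→ : ∀ {a b n m} → Φ (merge a b) n m → Eval (mergeP (decode a) (decode b)) n m
Φ-merge→ {a} {b} φ = subst (λ c → Eval c _ _) (fill-mergeT (decode a) (decode b)) (Φ-fill→ mergeT φ)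

Φ-merge← : ∀ {a b n m} → Eval (mergeP (decode a) (decode b)) n m → Φ (merge a b) n m
Φ-merge← {a} {b} ev =
  Φ-fill← mergeT (subst (λ c → Eval c _ _) (sym (fill-mergeT (decode a) (decode b))) ev)

choose-decode : ∀ s a b → choose s (decode a) (decode b) ≡ decode (choose s a b)
choose-decode L a b = refl
choose-decode R a b = refl

merge-splits : ∀ a b → Splits (Φ (merge a b)) (λ s → Φ (choose s a b))
merge-splits a b = record { from-side = from ; to-side = to }
  where
  from : ∀ s {n y} → Φ (merge a b) n (ι s y) → Σ ℕ λ k → Φ (choose s a b) k y
  from s φ with merge-inv (Φ-merge→ φ)
  ... | s' , k , y' , ev , ιy≡ι'y' with ι-injective {s} {s'} ιy≡ι'y'
  ... | refl , refl = k , Eval→Φ (subst (λ c → Eval c k _) (choose-decode s a b) ev)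
  to : ∀ s {k y} → Φ (choose s a b) k y → Σ ℕ λ n → Φ (merge a b) n (ι s y)
  to s {k} φ = pair k (tag s) ,
    Φ-merge← (merge-eval s (subst (λ c → Eval c k _) (sym (choose-decode s a b)) (Φ→Eval φ)))

splitIndex : ℕ → ℕ
splitIndex e = pair (restrict L e) (restrict R e)

splitIndex-computable : Computable splitIndex
splitIndex-computable = pair' (restrictP L) (restrictP R) , λ n → ev-pair (restrict-eval L n) (restrict-eval R n)
  where
  restrictP : Side → Code
  restrictP s = fillP (restrictT s) idP idP
  restrict-eval : ∀ s n → Eval (restrictP s) n (restrict s n)
  restrict-eval s n = fill-eval (restrictT s) (id-eval n) (id-eval n)

jump-⊕≤jump-× : ∀ E F → Jump (E ⊕ F) ≤c (Jump E ⊗ Jump F)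
jump-⊕≤jump-× E F = reduction {Jump (E ⊕ F)} {Jump E ⊗ Jump F} splitIndex splitIndex-computable λ e e' →
  ⇔-trans (match-⊕ (restrict-splits e) (restrict-splits e')) (⇔-sym ⊗-pair)

mergeIndex : ℕ → ℕ
mergeIndex x = merge (fst x) (snd x)

mergeIndex-computable : Computable mergeIndex
mergeIndex-computable = fillP mergeT left' right' , λ n → fill-eval mergeT (left-eval n) (right-eval n)

jump-×≤jump-⊕ : ∀ E F → (Jump E ⊗ Jump F) ≤c Jump (E ⊕ F)
jump-×≤jump-⊕ E F = reduction {Jump E ⊗ Jump F} {Jump (E ⊕ F)} mergeIndex mergeIndex-computable λ x x' →
  ⇔-trans ⊗-unpair (⇔-sym (match-⊕ (merge-splits (fst x) (snd x)) (merge-splits (fst x') (snd x'))))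

proposition2p3 : (E F : BinRel) → IsEquivalence E → IsEquivalence F →
                 Bireducible (Jump (E ⊕ F)) (Jump E ⊗ Jump F)
proposition2p3 E F _ _ = jump-⊕≤jump-× E F , jump-×≤jump-⊕ E F
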